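{- Let $l:\mathbf{K}\to\mathbf{L}$ be a morphism of polarized graphs and $m:\mathbf{L}\to\mathbf{G}$ a matching of polarized graphs, regarded as an inclusion, so that $\mathbf{G}=(\mathbf{L}+\overline{\mathbf{L}})+_e\widetilde{\mathbf{L}}$ as in the decomposition described in the context, with $m$ the canonical inclusion. Then the pullback complements of $(m,l)$ in the category $\mathbf{Gr}^{\mathrm{pol}}$ of polarized graphs are, up to isomorphism, exactly the squares $$m\circ l=l_1\circ d,\qquad \mathbf{D}=(\mathbf{K}+\overline{\mathbf{K}})+_e\widetilde{\mathbf{K}},\qquad l_1=(l+\overline{l})+_e\widetilde{l}:\mathbf{D}\to\mathbf{G},$$ where $d:\mathbf{K}\to\mathbf{D}$ is the canonical inclusion, the polarized graph $\overline{\mathbf{K}}$ and the morphism of polarized graphs $\overline{l}:\overline{\mathbf{K}}\to\overline{\mathbf{L}}$ are arbitrary, $\widetilde{\mathbf{K}}$ is any polarized graph whose nodes are contained in those of $\mathbf{K}+\overline{\mathbf{K}}$ as polarized graphs (i.e. $|\widetilde K|\subseteq|K|+|\overline K|$, $|\widetilde K|^+\subseteq|K|^++|\overline K|^+$, $|\widetilde K|^-\subseteq|K|^-+|\overline K|^-$), and $\widetilde{l}:\widetilde{\mathbf{K}}\to\widetilde{\mathbf{L}}$ is any morphism of polarized graphs which coincides with $l+\overline{l}$ on nodes. That is: (i) every such square is a pullback square in $\mathbf{Gr}^{\mathrm{pol}}$; and (ii) every pullback complement $\mathbf{G}\xleftarrow{l_1'}\mathbf{D}'\xleftarrow{d'}\mathbf{K}$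 of $\mathbf{G}\xleftarrow{m}\mathbf{L}\xleftarrow{l}\mathbf{K}$ is isomorphic (via an isomorphism $\phi:\mathbf{D}'\to\mathbf{D}$ with $\phi\circ d'=d$ and $l_1\circ\phi=l_1'$) to such a square.
   Context: A graph $X$ (directed multigraph) consists of nodes $|X|$, edges $\vec X$, and source and target functions; morphisms preserve source and target. A polarization $X^{\mathrm{pol}}$ of $X$ is a triple $(|X|^+,|X|^-,\vec X^\star)$ with $|X|^+,|X|^-\subseteq|X|$ and $\vec X^\star\subseteq\vec X$ such that each edge in $\vec X^\star$ has source in $|X|^+$ and target in $|X|^-$. A polarized graph $\mathbf{X}=(X,X^{\mathrm{pol}})$ is a graph with a polarization. A morphism of polarized graphs $f:\mathbf{X}\to\mathbf{Y}$ is a graph morphism with $f(|X|^+)\subseteq|Y|^+$, $f(|X|^-)\subseteq|Y|^-$, $f(\vec X^\star)\subseteq\vec Y^\star$; this gives the category $\mathbf{Gr}^{\mathrm{pol}}$. A matching of polarized graphs is a monomorphism $f:\mathbf{X}\to\mathbf{Y}$ (injective on nodes and edges) with $f(X^{\mathrm{pol}})=f(X)\cap Y^{\mathrm{pol}}$ componentwise. The sum $\mathbf{X}_1+\mathbf{X}_2$ is the disjoint union of graphs with the disjoint unions of the three polarization sets. For polarized graphs $\mathbf{X},\mathbf{E}$ with $|E|\subseteq|X|$, $|E|^+\subseteq|X|^+$, $|E|^-\subseteq|X|^-$, the edge-sum $\mathbf{X}+_e\mathbf{E}$ has nodes $|X|$, edges $\vec X+\vec E$ (source/target induced), $|X|^+$,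 $|X|^-$ as node polarizations and $\vec X^\star+\vec E^\star$ as polarized edges. Sums and edge-sums of morphisms are defined piecewise. For a subgraph $X$ of a graph $Y$: $\overline X$ is the subgraph of $Y$ generated by the nodes not in $X$ (with all edges of $Y$ between them) and $\widetilde X$ the subgraph generated by the edges of $Y$ neither in $X$ nor in $\overline X$, so $Y=(X+\overline X)+_e\widetilde X$. If $\mathbf{X}\subseteq\mathbf{Y}$ is a matching (inclusion), set $\overline{\mathbf{X}}=(\overline X,\overline X\cap Y^{\mathrm{pol}})$ and $\widetilde{\mathbf{X}}=(\widetilde X,\widetilde X\cap Y^{\mathrm{pol}})$; then $\mathbf{Y}=(\mathbf{X}+\overline{\mathbf{X}})+_e\widetilde{\mathbf{X}}$. $\mathbf{G}\xleftarrow{l_1}\mathbf{D}\xleftarrow{d}\mathbf{K}$ is a pullback complement of $\mathbf{G}\xleftarrow{m}\mathbf{L}\xleftarrow{l}\mathbf{K}$ if $\mathbf{L}\xleftarrow{l}\mathbf{K}\xrightarrow{d}\mathbf{D}$ is a pullback of $\mathbf{L}\xrightarrow{m}\mathbf{G}\xleftarrow{l_1}\mathbf{D}$. -}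

module Defs where

open import Data.Product using (Σ; Σ-syntax; _×_; _,_; proj₁; proj₂)
open import Data.Sum using (_⊎_; inj₁; inj₂; [_,_]; map)
open import Data.Empty using (⊥)
open import Data.Unit using (⊤)
open import Relation.Binary.PropositionalEquality using (_≡_; refl; cong)

record PGraph : Set₁ where
  field
    Node : Set
    Edge : Set
    src  : Edge → Node
    tgt  : Edge → Node
    Pos  : Node → Set
    Neg  : Node → Set
    Pol  : Edge → Set
    pol-src : ∀ e → Pol e → Pos (src e)
    pol-tgt : ∀ e → Pol e → Neg (tgt e)
open PGraph public

record Hom (X Y : PGraph) : Set where
  field
    node : Node X → Node Y
    edge : Edge X → Edge Y
    src-comm : ∀ e → src Y (edge e) ≡ node (src X e)
    tgt-comm : ∀ e → tgt Y (edge e) ≡ node (tgt X e)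
    pos-pres : ∀ n → Pos X n → Pos Y (node n)
    neg-pres : ∀ n → Neg X n → Neg Y (node n)
    pol-pres : ∀ e → Pol X e → Pol Y (edge e)
open Hom public

_≈_ : ∀ {X Y} → Hom X Y → Hom X Y → Set
f ≈ g = (∀ n → node f n ≡ node g n) × (∀ e → edge f e ≡ edge g e)

idH : ∀ {X} → Hom X X
idH = record { node = λ n → n ; edge = λ e → e ; src-comm = λ _ → refl
             ; tgt-comm = λ _ → refl ; pos-pres = λ _ p → p ; neg-pres = λ _ p → p
             ; pol-pres = λ _ p → p }

trans' : ∀ {A : Set} {a b c : A} → a ≡ b → b ≡ c → a ≡ c
trans' refl q = q

_∘H_ : ∀ {X Y Z} → Hom Y Z → Hom X Y → Hom X Z
g ∘H f = record
  { node = λ n → node g (node f n)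
  ; edge = λ e → edge g (edge f e)
  ; src-comm = λ e → trans' (src-comm g (edge f e)) (cong (node g) (src-comm f e))
  ; tgt-comm = λ e → trans' (tgt-comm g (edge f e)) (cong (node g) (tgt-comm f e))
  ; pos-pres = λ n p → pos-pres g _ (pos-pres f n p)
  ; neg-pres = λ n p → neg-pres g _ (neg-pres f n p)
  ; pol-pres = λ e p → pol-pres g _ (pol-pres f e p) }

IsIso : ∀ {X Y} → Hom X Y → Set
IsIso {X} {Y} f = Σ[ g ∈ Hom Y X ] ((g ∘H f) ≈ idH × (f ∘H g) ≈ idH)

Injective : {A B : Set} → (A → B) → Set
Injective f = ∀ {a b} → f a ≡ f b → a ≡ b

IsMatching : ∀ {X Y} → Hom X Y → Set
IsMatching {X} {Y} f =
  Injective (node f) × Injective (edge f) ×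
  (∀ n → Pos Y (node f n) → Pos X n) ×
  (∀ n → Neg Y (node f n) → Neg X n) ×
  (∀ e → Pol Y (edge f e) → Pol X e)

IsPullback : ∀ {A B C P} (f : Hom B A) (g : Hom C A) (p : Hom P B) (q : Hom P C) → Set₁
IsPullback {A} {B} {C} {P} f g p q =
  ((f ∘H p) ≈ (g ∘H q)) ×
  (∀ (Q : PGraph) (x : Hom Q B) (y : Hom Q C) → (f ∘H x) ≈ (g ∘H y) →
     Σ[ u ∈ Hom Q P ] ((p ∘H u) ≈ x × (q ∘H u) ≈ y ×
        (∀ (u' : Hom Q P) → (p ∘H u') ≈ x → (q ∘H u') ≈ y → u' ≈ u)))

IsPullbackComplement : ∀ {G L K D} (m : Hom L G) (l : Hom K L)
  (l₁ : Hom D G) (d : Hom K D) → Set₁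
IsPullbackComplement m l l₁ d = IsPullback m l₁ l d

_⊕_ : PGraph → PGraph → PGraph
X ⊕ Y = record
  { Node = Node X ⊎ Node Y
  ; Edge = Edge X ⊎ Edge Y
  ; src = map (src X) (src Y)
  ; tgt = map (tgt X) (tgt Y)
  ; Pos = [ Pos X , Pos Y ]
  ; Neg = [ Neg X , Neg Y ]
  ; Pol = [ Pol X , Pol Y ]
  ; pol-src = λ { (inj₁ e) p → pol-src X e p ; (inj₂ e) p → pol-src Y e p }
  ; pol-tgt = λ { (inj₁ e) p → pol-tgt X e p ; (inj₂ e) p → pol-tgt Y e p } }

_⊕H_ : ∀ {X Y X' Y'} → Hom X X' → Hom Y Y' → Hom (X ⊕ Y) (X' ⊕ Y')
f ⊕H g = record
  { node = map (node f) (node g)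
  ; edge = map (edge f) (edge g)
  ; src-comm = λ { (inj₁ e) → cong inj₁ (src-comm f e) ; (inj₂ e) → cong inj₂ (src-comm g e) }
  ; tgt-comm = λ { (inj₁ e) → cong inj₁ (tgt-comm f e) ; (inj₂ e) → cong inj₂ (tgt-comm g e) }
  ; pos-pres = λ { (inj₁ n) p → pos-pres f n p ; (inj₂ n) p → pos-pres g n p }
  ; neg-pres = λ { (inj₁ n) p → neg-pres f n p ; (inj₂ n) p → neg-pres g n p }
  ; pol-pres = λ { (inj₁ e) p → pol-pres f e p ; (inj₂ e) p → pol-pres g e p } }

inl : ∀ {X Y} → Hom X (X ⊕ Y)
inl = record { node = inj₁ ; edge = inj₁ ; src-comm = λ _ → refl ; tgt-comm = λ _ → refl
             ; pos-pres = λ _ p → p ; neg-pres = λ _ p → p ; pol-pres = λ _ p → p }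

-- A polarized graph E with |E| ⊆ |X|, |E|⁺ ⊆ |X|⁺, |E|⁻ ⊆ |X|⁻
-- only contributes its edges (with endpoints in |X|) and its polarized
-- edges (source in |X|⁺, target in |X|⁻) to X +ₑ E; this data is
-- recorded as an "edge extension" of X.

record EdgeExt (X : PGraph) : Set₁ where
  field
    EEdge : Set
    esrc  : EEdge → Node X
    etgt  : EEdge → Node X
    EPol  : EEdge → Set
    epol-src : ∀ e → EPol e → Pos X (esrc e)
    epol-tgt : ∀ e → EPol e → Neg X (etgt e)
open EdgeExt public

_+ₑ_ : (X : PGraph) → EdgeExt X → PGraph
X +ₑ E = record
  { Node = Node X
  ; Edge = Edge X ⊎ EEdge E
  ; src = [ src X , esrc E ]
  ; tgt = [ tgt X , etgt E ]
  ; Pos = Pos X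
  ; Neg = Neg X
  ; Pol = [ Pol X , EPol E ]
  ; pol-src = λ { (inj₁ e) p → pol-src X e p ; (inj₂ e) p → epol-src E e p }
  ; pol-tgt = λ { (inj₁ e) p → pol-tgt X e p ; (inj₂ e) p → epol-tgt E e p } }

-- A morphism of polarized graphs Ẽ → Ẽ' which coincides with f on nodes
record EdgeExtHom {X Y : PGraph} (f : Hom X Y) (E : EdgeExt X) (E' : EdgeExt Y) : Set where
  field
    eedge : EEdge E → EEdge E'
    esrc-comm : ∀ e → esrc E' (eedge e) ≡ node f (esrc E e)
    etgt-comm : ∀ e → etgt E' (eedge e) ≡ node f (etgt E e)
    epol-pres : ∀ e → EPol E e → EPol E' (eedge e)
open EdgeExtHom public

_+ₑH_ : ∀ {X Y} {E : EdgeExt X} {E' : EdgeExt Y} (f : Hom X Y) →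
        EdgeExtHom f E E' → Hom (X +ₑ E) (Y +ₑ E')
f +ₑH g = record
  { node = node f
  ; edge = map (edge f) (eedge g)
  ; src-comm = λ { (inj₁ e) → src-comm f e ; (inj₂ e) → esrc-comm g e }
  ; tgt-comm = λ { (inj₁ e) → tgt-comm f e ; (inj₂ e) → etgt-comm g e }
  ; pos-pres = pos-pres f
  ; neg-pres = neg-pres f
  ; pol-pres = λ { (inj₁ e) p → pol-pres f e p ; (inj₂ e) p → epol-pres g e p } }

incₑ : ∀ {X} {E : EdgeExt X} → Hom X (X +ₑ E)
incₑ = record { node = λ n → n ; edge = inj₁ ; src-comm = λ _ → refl ; tgt-comm = λ _ → refl
              ; pos-pres = λ _ p → p ; neg-pres = λ _ p → p ; pol-pres = λ _ p → p }

-- The decomposition  G = (L + L̄) +ₑ L̃  of the codomain of a matching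
-- L ⊆ G : L̄ is the full subgraph on the nodes outside L, so every edge of
-- L̃ has at least one endpoint in L.

IsLeft : ∀ {A B : Set} → A ⊎ B → Set
IsLeft (inj₁ _) = ⊤
IsLeft (inj₂ _) = ⊥

IsDecomposition : (L L̄ : PGraph) → EdgeExt (L ⊕ L̄) → Set
IsDecomposition L L̄ L̃ = ∀ e → IsLeft (esrc L̃ e) ⊎ IsLeft (etgt L̃ e)

canon : ∀ {L L̄} {L̃ : EdgeExt (L ⊕ L̄)} → Hom L ((L ⊕ L̄) +ₑ L̃)
canon = incₑ ∘H inl

module Submission where

-- Write G = (L + L̄) +ₑ L̃ with m = canon : L → G, and l : K → L.  Both halves of
-- the theorem rest on one description of pullbacks along a matching f : B → A:
--
--  * (criterion) a commuting square f ∘ p = g ∘ q is a pullback as soon as q is a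
--    matching and every node/edge of C that g sends into the image of f is in
--    the image of q (mediating maps are obtained by factoring through q);
--  * (converse) in a pullback of f, the map q is again a matching, and every
--    node/edge of C over the image of f lifts to P; this is read off from the
--    universal property tested on one-node and one-edge graphs.
--
-- Part (i) is the criterion applied to the canonical square.  For part (ii),
-- given a pullback complement G ←l₁′ D′ ←d′ K, the converse splits the nodes and
-- edges of D′ by where l₁′ sends them: over L they are exactly the image of d′,
-- over L̄ they form K̄ (with l̄ the restriction of l₁′), and the remaining edges,
-- over L̃, form K̃.  The evident map ψ : (K + K̄) +ₑ K̃ → D′ is bijective and
-- reflects the polarization, hence has an inverse morphism φ, which is the
-- required isomorphism.

open import Defs
open import Data.Empty using (⊥; ⊥-elim)
open import Data.Unit using (⊤; tt)
open import Data.Product using (Σ; Σ-syntax; _×_; _,_; proj₁; proj₂)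
open import Data.Sum using (_⊎_; inj₁; inj₂; [_,_]; [_,_]′; map)
open import Data.Sum.Properties using (inj₁-injective; inj₂-injective)
open import Function using (_∘_)
open import Level using (0ℓ)
open import Relation.Binary.Bundles using (Setoid)
open import Relation.Binary.PropositionalEquality
  using (_≡_; refl; sym; trans; cong; subst; module ≡-Reasoning)
import Relation.Binary.Reasoning.Setoid

-- Since _≈_ unfolds to pointwise equations, morphisms cannot
-- be inferred from its type, so lemmas about _≈_ take them explicitly.

≈-refl : ∀ {X Y} (f : Hom X Y) → f ≈ f
≈-refl _ = (λ _ → refl) , (λ _ → refl)

Hom-setoid : PGraph → PGraph → Setoid 0ℓ 0ℓ
Hom-setoid X Y = record
  { Carrier = Hom X Y
  ; _≈_ = _≈_
  ; isEquivalence = record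
    { refl = λ {f} → ≈-refl f
    ; sym = λ (n , e) → (λ x → sym (n x)) , (λ x → sym (e x))
    ; trans = λ (n , e) (n′ , e′) → (λ x → trans (n x) (n′ x)) , (λ x → trans (e x) (e′ x))
    }
  }

module ≈-Reasoning {X Y : PGraph} = Relation.Binary.Reasoning.Setoid (Hom-setoid X Y)

∘-congˡ : ∀ {X Y Z} (h : Hom Y Z) (f g : Hom X Y) → f ≈ g → (h ∘H f) ≈ (h ∘H g)
∘-congˡ h _ _ (n , e) = (λ x → cong (node h) (n x)) , (λ x → cong (edge h) (e x))

∘-congʳ : ∀ {X Y Z} (f g : Hom Y Z) (h : Hom X Y) → f ≈ g → (f ∘H h) ≈ (g ∘H h)
∘-congʳ _ _ h (n , e) = (λ x → n (node h x)) , (λ x → e (edge h x))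

IsRight : ∀ {A B : Set} → A ⊎ B → Set
IsRight (inj₁ _) = ⊥
IsRight (inj₂ _) = ⊤

fromRight : ∀ {A B : Set} (v : A ⊎ B) → IsRight v → B
fromRight (inj₂ b) _ = b

fromRight-eq : ∀ {A B : Set} (v : A ⊎ B) (r : IsRight v) → inj₂ (fromRight v r) ≡ v
fromRight-eq (inj₂ _) _ = refl

fromRight-pred : ∀ {A B : Set} {P : A → Set} {Q : B → Set} (v : A ⊎ B) (r : IsRight v) →
  [ P , Q ] v → Q (fromRight v r)
fromRight-pred (inj₂ _) _ q = q

IsRight-irrelevant : ∀ {A B : Set} (v : A ⊎ B) (r r′ : IsRight v) → r ≡ r′
IsRight-irrelevant (inj₂ _) _ _ = refl

IsMid : ∀ {A B C : Set} → (A ⊎ B) ⊎ C → Set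
IsMid = [ IsRight , (λ _ → ⊥) ]

fromMid : ∀ {A B C : Set} (w : (A ⊎ B) ⊎ C) → IsMid w → B
fromMid (inj₁ v) r = fromRight v r

fromMid-eq : ∀ {A B C : Set} (w : (A ⊎ B) ⊎ C) (r : IsMid w) → inj₁ (inj₂ (fromMid w r)) ≡ w
fromMid-eq (inj₁ v) r = cong inj₁ (fromRight-eq v r)

fromMid-pred : ∀ {A B C : Set} {P : A → Set} {Q : B → Set} {R : C → Set}
  (w : (A ⊎ B) ⊎ C) (r : IsMid w) → [ [ P , Q ] , R ] w → Q (fromMid w r)
fromMid-pred (inj₁ v) r = fromRight-pred v r

IsMid-irrelevant : ∀ {A B C : Set} (w : (A ⊎ B) ⊎ C) (r r′ : IsMid w) → r ≡ r′
IsMid-irrelevant (inj₁ v) = IsRight-irrelevant v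

mid-not-right : ∀ {A B C : Set} (w : (A ⊎ B) ⊎ C) → IsMid w → IsRight w → ⊥
mid-not-right (inj₁ _) _ ()

mid-incidence : ∀ {A B C A′ B′ : Set} (s : A → A′) (s′ : B → B′) (s″ : C → A′ ⊎ B′)
  (w : (A ⊎ B) ⊎ C) (r : IsMid w) → [ map s s′ , s″ ]′ w ≡ inj₂ (s′ (fromMid w r))
mid-incidence s s′ s″ (inj₁ (inj₂ _)) _ = refl

right-incidence : ∀ {A C N : Set} (s : A → N) (s″ : C → N) (w : A ⊎ C) (r : IsRight w) →
  [ s , s″ ]′ w ≡ s″ (fromRight w r)
right-incidence s s″ (inj₂ _) _ = refl

Reflects : ∀ {X Y} → Hom X Y → Set
Reflects {X} {Y} f =
  (∀ n → Pos Y (node f n) → Pos X n) × (∀ n → Neg Y (node f n) → Neg X n) ×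
  (∀ e → Pol Y (edge f e) → Pol X e)

monic : ∀ {X Y Q} (m : Hom X Y) (u v : Hom Q X) → Injective (node m) → Injective (edge m) →
  (m ∘H u) ≈ (m ∘H v) → u ≈ v
monic _ _ _ inj-node inj-edge (n , e) = (λ x → inj-node (n x)) , (λ x → inj-edge (e x))

factorThrough : ∀ {X Y Q} (m : Hom X Y) → IsMatching m → (y : Hom Q Y)
  (un : Node Q → Node X) (ue : Edge Q → Edge X) →
  (∀ z → node m (un z) ≡ node y z) → (∀ e → edge m (ue e) ≡ edge y e) → Hom Q X
factorThrough {X} {Y} {Q} m (inj-node , _ , reflects-pos , reflects-neg , reflects-pol) y un ue over-n over-e =
  record
    { node = un
    ; edge = ue
    ; src-comm = incidence (src X) (src Y) (src Q) (src-comm m) (src-comm y)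
    ; tgt-comm = incidence (tgt X) (tgt Y) (tgt Q) (tgt-comm m) (tgt-comm y)
    ; pos-pres = λ z p → reflects-pos (un z) (subst (Pos Y) (sym (over-n z)) (pos-pres y z p))
    ; neg-pres = λ z p → reflects-neg (un z) (subst (Neg Y) (sym (over-n z)) (neg-pres y z p))
    ; pol-pres = λ e p → reflects-pol (ue e) (subst (Pol Y) (sym (over-e e)) (pol-pres y e p))
    }
  where
  open ≡-Reasoning
  incidence : (sX : Edge X → Node X) (sY : Edge Y → Node Y) (sQ : Edge Q → Node Q) →
    (∀ e → sY (edge m e) ≡ node m (sX e)) → (∀ e → sY (edge y e) ≡ node y (sQ e)) →
    ∀ e → sX (ue e) ≡ un (sQ e)
  incidence sX sY sQ m-comm y-comm e = inj-node (begin
    node m (sX (ue e))  ≡⟨ sym (m-comm (ue e)) ⟩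
    sY (edge m (ue e))  ≡⟨ cong sY (over-e e) ⟩
    sY (edge y e)       ≡⟨ y-comm e ⟩
    node y (sQ e)       ≡⟨ sym (over-n (sQ e)) ⟩
    node m (un (sQ e))  ∎)

canon-matching : ∀ {K K̄} {K̃ : EdgeExt (K ⊕ K̄)} → IsMatching (canon {K} {K̄} {K̃})
canon-matching =
  inj₁-injective , (λ eq → inj₁-injective (inj₁-injective eq)) ,
  (λ _ p → p) , (λ _ p → p) , (λ _ p → p)

preserve-by-inverse : ∀ {A B : Set} {P : B → Set} {Q : A → Set} (f : A → B) (g : B → A) →
  (∀ b → f (g b) ≡ b) → (∀ a → P (f a) → Q a) → ∀ b → P b → Q (g b)
preserve-by-inverse {P = P} f g f∘g reflects b p = reflects (g b) (subst P (sym (f∘g b)) p)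

inverseHom : ∀ {X Y} (f : Hom X Y) (g₀ : Node Y → Node X) (g₁ : Edge Y → Edge X) →
  (∀ x → g₀ (node f x) ≡ x) → (∀ y → node f (g₀ y) ≡ y) → (∀ e → edge f (g₁ e) ≡ e) →
  Reflects f → Hom Y X
inverseHom {X} {Y} f g₀ g₁ g₀∘f f∘g₀ f∘g₁ (reflects-pos , reflects-neg , reflects-pol) = record
  { node = g₀
  ; edge = g₁
  ; src-comm = incidence (src X) (src Y) (src-comm f)
  ; tgt-comm = incidence (tgt X) (tgt Y) (tgt-comm f)
  ; pos-pres = preserve-by-inverse (node f) g₀ f∘g₀ reflects-pos
  ; neg-pres = preserve-by-inverse (node f) g₀ f∘g₀ reflects-neg
  ; pol-pres = preserve-by-inverse (edge f) g₁ f∘g₁ reflects-pol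
  }
  where
  open ≡-Reasoning
  incidence : (sX : Edge X → Node X) (sY : Edge Y → Node Y) →
    (∀ e → sY (edge f e) ≡ node f (sX e)) → ∀ e → sX (g₁ e) ≡ g₀ (sY e)
  incidence sX sY f-comm e = begin
    sX (g₁ e)                  ≡⟨ sym (g₀∘f (sX (g₁ e))) ⟩
    g₀ (node f (sX (g₁ e)))    ≡⟨ cong g₀ (sym (f-comm (g₁ e))) ⟩
    g₀ (sY (edge f (g₁ e)))    ≡⟨ cong (g₀ ∘ sY) (f∘g₁ e) ⟩
    g₀ (sY e)                  ∎

-- Test objects: the one-node graph and the one-edge graph generated by a node,
-- resp. an edge, of X (with the polarization inherited from X), and X with its
-- polarization forgotten.  Morphisms out of them pick out nodes and edges.

data Endpoint : Set where
  source target : Endpoint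

endpoint : (X : PGraph) → Edge X → Endpoint → Node X
endpoint X e source = src X e
endpoint X e target = tgt X e

endpoint-comm : ∀ {X Y} (f : Hom X Y) e i → endpoint Y (edge f e) i ≡ node f (endpoint X e i)
endpoint-comm f e source = src-comm f e
endpoint-comm f e target = tgt-comm f e

unpolarized : PGraph → PGraph
unpolarized X = record
  { Node = Node X ; Edge = Edge X ; src = src X ; tgt = tgt X
  ; Pos = λ _ → ⊥ ; Neg = λ _ → ⊥ ; Pol = λ _ → ⊥ ; pol-src = λ _ () ; pol-tgt = λ _ () }

pointOf : (X : PGraph) → Node X → PGraph
pointOf X n = record
  { Node = ⊤ ; Edge = ⊥ ; src = λ () ; tgt = λ ()
  ; Pos = λ _ → Pos X n ; Neg = λ _ → Neg X n ; Pol = λ () ; pol-src = λ () ; pol-tgt = λ () }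

arrowOf : (X : PGraph) → Edge X → PGraph
arrowOf X e = record
  { Node = Endpoint ; Edge = ⊤ ; src = λ _ → source ; tgt = λ _ → target
  ; Pos = Pos X ∘ endpoint X e ; Neg = Neg X ∘ endpoint X e ; Pol = λ _ → Pol X e
  ; pol-src = λ _ → pol-src X e ; pol-tgt = λ _ → pol-tgt X e }

pointHom : ∀ {X Y} (n : Node X) (n′ : Node Y) →
  (Pos X n → Pos Y n′) → (Neg X n → Neg Y n′) → Hom (pointOf X n) Y
pointHom n n′ pos neg = record
  { node = λ _ → n′ ; edge = λ () ; src-comm = λ () ; tgt-comm = λ ()
  ; pos-pres = λ _ → pos ; neg-pres = λ _ → neg ; pol-pres = λ () }

arrowHom : ∀ {X Y} (e : Edge X) (e′ : Edge Y) →
  (∀ i → Pos X (endpoint X e i) → Pos Y (endpoint Y e′ i)) →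
  (∀ i → Neg X (endpoint X e i) → Neg Y (endpoint Y e′ i)) →
  (Pol X e → Pol Y e′) → Hom (arrowOf X e) Y
arrowHom {Y = Y} e e′ pos neg pol = record
  { node = endpoint Y e′ ; edge = λ _ → e′ ; src-comm = λ _ → refl ; tgt-comm = λ _ → refl
  ; pos-pres = pos ; neg-pres = neg ; pol-pres = λ _ → pol }

pullback-criterion : ∀ {A B C P} {f : Hom B A} {g : Hom C A} {p : Hom P B} {q : Hom P C} →
  Injective (node f) → Injective (edge f) → IsMatching q → (f ∘H p) ≈ (g ∘H q) →
  (∀ c b → node g c ≡ node f b → Σ[ k ∈ Node P ] node q k ≡ c) →
  (∀ e b → edge g e ≡ edge f b → Σ[ k ∈ Edge P ] edge q k ≡ e) →
  IsPullback f g p q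
pullback-criterion {B = B} {C = C} {P = P} {f = f} {g = g} {p = p} {q = q}
  f-inj-node f-inj-edge q-matching square covers-node covers-edge = square , universal
  where
  universal : ∀ (Q : PGraph) (x : Hom Q B) (y : Hom Q C) → (f ∘H x) ≈ (g ∘H y) →
    Σ[ u ∈ Hom Q P ] ((p ∘H u) ≈ x × (q ∘H u) ≈ y ×
      (∀ (u′ : Hom Q P) → (p ∘H u′) ≈ x → (q ∘H u′) ≈ y → u′ ≈ u))
  universal Q x y fx≈gy = u , p∘u≈x , q∘u≈y , unique
    where
    lift-node : ∀ z → Σ[ k ∈ Node P ] node q k ≡ node y z
    lift-node z = covers-node (node y z) (node x z) (sym (proj₁ fx≈gy z))
    lift-edge : ∀ e → Σ[ k ∈ Edge P ] edge q k ≡ edge y e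
    lift-edge e = covers-edge (edge y e) (edge x e) (sym (proj₂ fx≈gy e))
    u : Hom Q P
    u = factorThrough q q-matching y (λ z → proj₁ (lift-node z)) (λ e → proj₁ (lift-edge e))
          (λ z → proj₂ (lift-node z)) (λ e → proj₂ (lift-edge e))
    q∘u≈y : (q ∘H u) ≈ y
    q∘u≈y = (λ z → proj₂ (lift-node z)) , (λ e → proj₂ (lift-edge e))
    p∘u≈x : (p ∘H u) ≈ x
    p∘u≈x = monic f (p ∘H u) x f-inj-node f-inj-edge (begin
      f ∘H (p ∘H u)  ≈⟨ ∘-congʳ (f ∘H p) (g ∘H q) u square ⟩
      g ∘H (q ∘H u)  ≈⟨ ∘-congˡ g (q ∘H u) y q∘u≈y ⟩
      g ∘H y         ≈⟨ fx≈gy ⟨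
      f ∘H x         ∎)
      where open ≈-Reasoning
    unique : ∀ (u′ : Hom Q P) → (p ∘H u′) ≈ x → (q ∘H u′) ≈ y → u′ ≈ u
    unique u′ _ q∘u′≈y = monic q u′ u (proj₁ q-matching) (proj₁ (proj₂ q-matching)) (begin
      q ∘H u′  ≈⟨ q∘u′≈y ⟩
      y        ≈⟨ q∘u≈y ⟨
      q ∘H u   ∎)
      where open ≈-Reasoning

module PullbackOfMatching {A B C P : PGraph} {f : Hom B A} {g : Hom C A} {p : Hom P B}
  {q : Hom P C} (f-matching : IsMatching f) (pb : IsPullback f g p q) where

  private
    square : (f ∘H p) ≈ (g ∘H q)
    square = proj₁ pb

    f-reflects : Reflects f
    f-reflects = proj₂ (proj₂ f-matching)

    mediate : ∀ {Q} (x : Hom Q B) (y : Hom Q C) → (f ∘H x) ≈ (g ∘H y) → Hom Q P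
    mediate x y fx≈gy = proj₁ (proj₂ pb _ x y fx≈gy)

    mediate-q : ∀ {Q} (x : Hom Q B) (y : Hom Q C) (fx≈gy : (f ∘H x) ≈ (g ∘H y)) →
      (q ∘H mediate x y fx≈gy) ≈ y
    mediate-q x y fx≈gy = proj₁ (proj₂ (proj₂ (proj₂ pb _ x y fx≈gy)))

    mediate-unique : ∀ {Q} (x : Hom Q B) (y : Hom Q C) (fx≈gy : (f ∘H x) ≈ (g ∘H y))
      (u : Hom Q P) → (p ∘H u) ≈ x → (q ∘H u) ≈ y → u ≈ mediate x y fx≈gy
    mediate-unique x y fx≈gy = proj₂ (proj₂ (proj₂ (proj₂ pb _ x y fx≈gy)))

    pull-pos : ∀ {c b} → node g c ≡ node f b → Pos C c → Pos B b
    pull-pos {c} {b} over z = proj₁ f-reflects b (subst (Pos A) over (pos-pres g c z))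

    pull-neg : ∀ {c b} → node g c ≡ node f b → Neg C c → Neg B b
    pull-neg {c} {b} over z = proj₁ (proj₂ f-reflects) b (subst (Neg A) over (neg-pres g c z))

    pull-pol : ∀ {e b} → edge g e ≡ edge f b → Pol C e → Pol B b
    pull-pol {e} {b} over z = proj₂ (proj₂ f-reflects) b (subst (Pol A) over (pol-pres g e z))

  -- q is a monomorphism, since f is and the pullback is jointly monic.
  q-monic : ∀ {Q} {u₁ u₂ : Hom Q P} → (q ∘H u₁) ≈ (q ∘H u₂) → u₁ ≈ u₂
  q-monic {Q} {u₁} {u₂} qu₁≈qu₂ = begin
    u₁                ≈⟨ mediate-unique x y comm u₁ pu₁≈pu₂ qu₁≈qu₂ ⟩
    mediate x y comm  ≈⟨ mediate-unique x y comm u₂ (≈-refl x) (≈-refl y) ⟨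
    u₂                ∎
    where
    open ≈-Reasoning
    x : Hom Q B
    x = p ∘H u₂
    y : Hom Q C
    y = q ∘H u₂
    comm : (f ∘H x) ≈ (g ∘H y)
    comm = ∘-congʳ (f ∘H p) (g ∘H q) u₂ square
    pu₁≈pu₂ : (p ∘H u₁) ≈ (p ∘H u₂)
    pu₁≈pu₂ = monic f (p ∘H u₁) (p ∘H u₂) (proj₁ f-matching) (proj₁ (proj₂ f-matching)) (begin
      f ∘H (p ∘H u₁)  ≈⟨ ∘-congʳ (f ∘H p) (g ∘H q) u₁ square ⟩
      g ∘H (q ∘H u₁)  ≈⟨ ∘-congˡ g (q ∘H u₁) (q ∘H u₂) qu₁≈qu₂ ⟩
      g ∘H (q ∘H u₂)  ≈⟨ comm ⟨
      f ∘H (p ∘H u₂)  ∎)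

  -- testing q-monic on unpolarized points and arrows
  q-injective-node : Injective (node q)
  q-injective-node {k₁} {k₂} eq = proj₁ (q-monic {u₁ = at k₁} {u₂ = at k₂} ((λ _ → eq) , λ ())) tt
    where
    at : Node P → Hom (pointOf (unpolarized P) k₁) P
    at k = pointHom {unpolarized P} k₁ k (λ ()) (λ ())

  q-injective-edge : Injective (edge q)
  q-injective-edge {k₁} {k₂} eq =
    proj₂ (q-monic {u₁ = along k₁} {u₂ = along k₂} (same-ends , λ _ → eq)) tt
    where
    open ≡-Reasoning
    along : Edge P → Hom (arrowOf (unpolarized P) k₁) P
    along k = arrowHom {unpolarized P} k₁ k (λ _ ()) (λ _ ()) (λ ())
    same-ends : ∀ i → node q (endpoint P k₁ i) ≡ node q (endpoint P k₂ i)
    same-ends i = begin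
      node q (endpoint P k₁ i)  ≡⟨ sym (endpoint-comm q k₁ i) ⟩
      endpoint C (edge q k₁) i  ≡⟨ cong (λ e → endpoint C e i) eq ⟩
      endpoint C (edge q k₂) i  ≡⟨ endpoint-comm q k₂ i ⟩
      node q (endpoint P k₂ i)  ∎

  -- testing the universal property on the polarized point at c
  lift-node : ∀ c b → node g c ≡ node f b →
    Σ[ k ∈ Node P ] (node q k ≡ c × (Pos C c → Pos P k) × (Neg C c → Neg P k))
  lift-node c b over = node u tt , proj₁ (mediate-q x y comm) tt , pos-pres u tt , neg-pres u tt
    where
    x : Hom (pointOf C c) B
    x = pointHom {C} c b (pull-pos over) (pull-neg over)
    y : Hom (pointOf C c) C
    y = pointHom {C} c c (λ z → z) (λ z → z)
    comm : (f ∘H x) ≈ (g ∘H y)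
    comm = (λ _ → sym over) , λ ()
    u : Hom (pointOf C c) P
    u = mediate x y comm

  -- testing the universal property on the polarized arrow at e
  lift-edge : ∀ e b → edge g e ≡ edge f b →
    Σ[ k ∈ Edge P ] (edge q k ≡ e × (Pol C e → Pol P k))
  lift-edge e b over = edge u tt , proj₂ (mediate-q x y comm) tt , pol-pres u tt
    where
    open ≡-Reasoning
    ends : ∀ i → node g (endpoint C e i) ≡ node f (endpoint B b i)
    ends i = begin
      node g (endpoint C e i)  ≡⟨ sym (endpoint-comm g e i) ⟩
      endpoint A (edge g e) i  ≡⟨ cong (λ a → endpoint A a i) over ⟩
      endpoint A (edge f b) i  ≡⟨ endpoint-comm f b i ⟩
      node f (endpoint B b i)  ∎
    x : Hom (arrowOf C e) B
    x = arrowHom {C} e b (λ i → pull-pos (ends i)) (λ i → pull-neg (ends i)) (pull-pol over)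
    y : Hom (arrowOf C e) C
    y = arrowHom {C} e e (λ _ z → z) (λ _ z → z) (λ z → z)
    comm : (f ∘H x) ≈ (g ∘H y)
    comm = (λ i → sym (ends i)) , (λ _ → sym over)
    u : Hom (arrowOf C e) P
    u = mediate x y comm

  -- q reflects the polarization: lift q k itself and use injectivity
  q-reflects : Reflects q
  q-reflects = reflect-pos , reflect-neg , reflect-pol
    where
    reflect-pos : ∀ k → Pos C (node q k) → Pos P k
    reflect-pos k z =
      let (_ , qk′≡qk , pos , _) = lift-node (node q k) (node p k) (sym (proj₁ square k))
      in subst (Pos P) (q-injective-node qk′≡qk) (pos z)
    reflect-neg : ∀ k → Neg C (node q k) → Neg P k
    reflect-neg k z =
      let (_ , qk′≡qk , _ , neg) = lift-node (node q k) (node p k) (sym (proj₁ square k))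
      in subst (Neg P) (q-injective-node qk′≡qk) (neg z)
    reflect-pol : ∀ k → Pol C (edge q k) → Pol P k
    reflect-pol k z =
      let (_ , qk′≡qk , pol) = lift-edge (edge q k) (edge p k) (sym (proj₂ square k))
      in subst (Pol P) (q-injective-edge qk′≡qk) (pol z)

-- Part (i): for arbitrary K̄, l̄, K̃ and l̃, the canonical square
--   canon ∘ l = ((l + l̄) +ₑ l̃) ∘ canon
-- is a pullback by the criterion: a node of (K + K̄) +ₑ K̃ sent into L lies in K,
-- and an edge sent into L is an edge of K (the remaining cases are impossible,
-- since l₁ sends them into L̄ or L̃).
canonical-square-is-pullback : ∀ {K L K̄ L̄} {K̃ : EdgeExt (K ⊕ K̄)} {L̃ : EdgeExt (L ⊕ L̄)}
  (l : Hom K L) (l̄ : Hom K̄ L̄) (l̃ : EdgeExtHom (l ⊕H l̄) K̃ L̃) →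
  IsPullbackComplement (canon {L} {L̄} {L̃}) l ((l ⊕H l̄) +ₑH l̃) (canon {K} {K̄} {K̃})
canonical-square-is-pullback {K = K} {K̄ = K̄} {K̃ = K̃} l l̄ l̃ =
  pullback-criterion {f = canon} {g = (l ⊕H l̄) +ₑH l̃} {p = l} {q = canon}
    inj₁-injective (λ eq → inj₁-injective (inj₁-injective eq)) (canon-matching {K} {K̄} {K̃})
    ((λ _ → refl) , (λ _ → refl)) covers-node covers-edge
  where
  covers-node : ∀ c b → node ((l ⊕H l̄) +ₑH l̃) c ≡ inj₁ b → Σ[ k ∈ Node K ] inj₁ k ≡ c
  covers-node (inj₁ k) _ _ = k , refl

  covers-edge : ∀ e b → edge ((l ⊕H l̄) +ₑH l̃) e ≡ inj₁ (inj₁ b) →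
    Σ[ k ∈ Edge K ] inj₁ (inj₁ k) ≡ e
  covers-edge (inj₁ (inj₁ k)) _ _ = k , refl

-- Over is the subgraph of nodes over Y and edges over Y (an edge over Y has
-- both endpoints over Y), mapped to Y by the restriction of h.  Given a
-- polarization-preserving node map r : |C| → |Z| with k ∘ r = h on nodes, the
-- edges of C over E form an edge extension of Z, mapped to E by h.
module OverSummands {C X Y : PGraph} {E : EdgeExt (X ⊕ Y)} (h : Hom C ((X ⊕ Y) +ₑ E)) where

  open ≡-Reasoning

  private
    over-Y : (s : Edge X → Node X) (s′ : Edge Y → Node Y) (s″ : EEdge E → Node (X ⊕ Y))
      (sC : Edge C → Node C) → (∀ e → [ map s s′ , s″ ]′ (edge h e) ≡ node h (sC e)) →
      ∀ e (r : IsMid (edge h e)) → node h (sC e) ≡ inj₂ (s′ (fromMid (edge h e) r))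
    over-Y s s′ s″ sC comm e r = trans (sym (comm e)) (mid-incidence s s′ s″ (edge h e) r)

    endpoint-over-Y : (s : Edge X → Node X) (s′ : Edge Y → Node Y) (s″ : EEdge E → Node (X ⊕ Y))
      (sC : Edge C → Node C) → (∀ e → [ map s s′ , s″ ]′ (edge h e) ≡ node h (sC e)) →
      ∀ e → IsMid (edge h e) → IsRight (node h (sC e))
    endpoint-over-Y s s′ s″ sC comm e r = subst IsRight (sym (over-Y s s′ s″ sC comm e r)) tt

    restriction-comm : (s : Edge X → Node X) (s′ : Edge Y → Node Y) (s″ : EEdge E → Node (X ⊕ Y))
      (sC : Edge C → Node C) (comm : ∀ e → [ map s s′ , s″ ]′ (edge h e) ≡ node h (sC e)) →
      ∀ e (r : IsMid (edge h e)) →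
      s′ (fromMid (edge h e) r) ≡ fromRight (node h (sC e)) (endpoint-over-Y s s′ s″ sC comm e r)
    restriction-comm s s′ s″ sC comm e r = inj₂-injective (begin
      inj₂ (s′ (fromMid (edge h e) r))  ≡⟨ over-Y s s′ s″ sC comm e r ⟨
      node h (sC e)                    ≡⟨ fromRight-eq (node h (sC e)) _ ⟨
      inj₂ (fromRight (node h (sC e)) _) ∎)

  Over : PGraph
  Over = record
    { Node = Σ[ n ∈ Node C ] IsRight (node h n)
    ; Edge = Σ[ e ∈ Edge C ] IsMid (edge h e)
    ; src = λ { (e , r) → src C e , endpoint-over-Y (src X) (src Y) (esrc E) (src C) (src-comm h) e r }
    ; tgt = λ { (e , r) → tgt C e , endpoint-over-Y (tgt X) (tgt Y) (etgt E) (tgt C) (tgt-comm h) e r }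
    ; Pos = λ { (n , _) → Pos C n }
    ; Neg = λ { (n , _) → Neg C n }
    ; Pol = λ { (e , _) → Pol C e }
    ; pol-src = λ { (e , _) → pol-src C e }
    ; pol-tgt = λ { (e , _) → pol-tgt C e }
    }

  over-hom : Hom Over Y
  over-hom = record
    { node = λ { (n , r) → fromRight (node h n) r }
    ; edge = λ { (e , r) → fromMid (edge h e) r }
    ; src-comm = λ { (e , r) → restriction-comm (src X) (src Y) (esrc E) (src C) (src-comm h) e r }
    ; tgt-comm = λ { (e , r) → restriction-comm (tgt X) (tgt Y) (etgt E) (tgt C) (tgt-comm h) e r }
    ; pos-pres = λ { (n , r) p → fromRight-pred (node h n) r (pos-pres h n p) }
    ; neg-pres = λ { (n , r) p → fromRight-pred (node h n) r (neg-pres h n p) }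
    ; pol-pres = λ { (e , r) p → fromMid-pred (edge h e) r (pol-pres h e p) }
    }

  module _ {Z : PGraph} (k : Hom Z (X ⊕ Y)) (r : Node C → Node Z)
    (r-over : ∀ n → node k (r n) ≡ node h n)
    (r-pos : ∀ n → Pos C n → Pos Z (r n)) (r-neg : ∀ n → Neg C n → Neg Z (r n)) where

    private
      extension-comm : (s : Edge (X ⊕ Y) → Node (X ⊕ Y)) (s″ : EEdge E → Node (X ⊕ Y))
        (sC : Edge C → Node C) → (∀ e → [ s , s″ ]′ (edge h e) ≡ node h (sC e)) →
        ∀ e (ρ : IsRight (edge h e)) → s″ (fromRight (edge h e) ρ) ≡ node k (r (sC e))
      extension-comm s s″ sC comm e ρ = begin
        s″ (fromRight (edge h e) ρ)  ≡⟨ right-incidence s s″ (edge h e) ρ ⟨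
        [ s , s″ ]′ (edge h e)       ≡⟨ comm e ⟩
        node h (sC e)                ≡⟨ r-over (sC e) ⟨
        node k (r (sC e))            ∎

    OverE : EdgeExt Z
    OverE = record
      { EEdge = Σ[ e ∈ Edge C ] IsRight (edge h e)
      ; esrc = λ { (e , _) → r (src C e) }
      ; etgt = λ { (e , _) → r (tgt C e) }
      ; EPol = λ { (e , _) → Pol C e }
      ; epol-src = λ { (e , _) p → r-pos (src C e) (pol-src C e p) }
      ; epol-tgt = λ { (e , _) p → r-neg (tgt C e) (pol-tgt C e p) }
      }

    overE-hom : EdgeExtHom k OverE E
    overE-hom = record
      { eedge = λ { (e , ρ) → fromRight (edge h e) ρ }
      ; esrc-comm = λ { (e , ρ) → extension-comm (src (X ⊕ Y)) (esrc E) (src C) (src-comm h) e ρ }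
      ; etgt-comm = λ { (e , ρ) → extension-comm (tgt (X ⊕ Y)) (etgt E) (tgt C) (tgt-comm h) e ρ }
      ; epol-pres = λ { (e , ρ) p → fromRight-pred (edge h e) ρ (pol-pres h e p) }
      }

module Complement {K L L̄ : PGraph} {L̃ : EdgeExt (L ⊕ L̄)} {l : Hom K L} {D′ : PGraph}
  {l₁′ : Hom D′ ((L ⊕ L̄) +ₑ L̃)} {d′ : Hom K D′}
  (pb : IsPullbackComplement (canon {L} {L̄} {L̃}) l l₁′ d′) where

  open PullbackOfMatching {f = canon {L} {L̄} {L̃}} {g = l₁′} {p = l} {q = d′}
    (canon-matching {L} {L̄} {L̃}) pb
  open OverSummands l₁′

  square-node : ∀ k → inj₁ (node l k) ≡ node l₁′ (node d′ k)
  square-node = proj₁ (proj₁ pb)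

  square-edge : ∀ k → inj₁ (inj₁ (edge l k)) ≡ edge l₁′ (edge d′ k)
  square-edge = proj₂ (proj₁ pb)

  -- K̄ and l̄ : the part of D′ over L̄
  K̄ : PGraph
  K̄ = Over

  l̄ : Hom K̄ L̄
  l̄ = over-hom

  NodeClass : Node D′ → Set
  NodeClass n = (Σ[ k ∈ Node K ] node d′ k ≡ n) ⊎ IsRight (node l₁′ n)

  classify-node : ∀ n → NodeClass n
  classify-node n = by-image (node l₁′ n) refl
    where
    by-image : ∀ v → node l₁′ n ≡ v → NodeClass n
    by-image (inj₁ a) over = inj₁ (let (k , dk≡n , _) = lift-node n a over in k , dk≡n)
    by-image (inj₂ _) over = inj₂ (subst IsRight (sym over) tt)

  node-of : ∀ {n} → NodeClass n → Node (K ⊕ K̄)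
  node-of {n} = map proj₁ (n ,_)

  φN : Node D′ → Node (K ⊕ K̄)
  φN n = node-of (classify-node n)

  ψN : Node (K ⊕ K̄) → Node D′
  ψN = [ node d′ , proj₁ ]

  ψφN : ∀ n → ψN (φN n) ≡ n
  ψφN n = ψ-node-of (classify-node n)
    where
    ψ-node-of : ∀ {n} (c : NodeClass n) → ψN (node-of c) ≡ n
    ψ-node-of (inj₁ (_ , dk≡n)) = dk≡n
    ψ-node-of (inj₂ _) = refl

  d′-node-not-over-L̄ : ∀ k → IsRight (node l₁′ (node d′ k)) → ⊥
  d′-node-not-over-L̄ k = subst IsRight (sym (square-node k))

  φψN : ∀ x → φN (ψN x) ≡ x
  φψN (inj₁ k) = node-of-image (classify-node (node d′ k))
    where
    node-of-image : (c : NodeClass (node d′ k)) → node-of c ≡ inj₁ k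
    node-of-image (inj₁ (_ , dk′≡dk)) = cong inj₁ (q-injective-node dk′≡dk)
    node-of-image (inj₂ r) = ⊥-elim (d′-node-not-over-L̄ k r)
  φψN (inj₂ (n , r)) = node-of-over (classify-node n)
    where
    node-of-over : (c : NodeClass n) → node-of c ≡ inj₂ (n , r)
    node-of-over (inj₁ (k , dk≡n)) =
      ⊥-elim (d′-node-not-over-L̄ k (subst (IsRight ∘ node l₁′) (sym dk≡n) r))
    node-of-over (inj₂ r′) = cong (λ ρ → inj₂ (n , ρ)) (IsRight-irrelevant (node l₁′ n) r′ r)

  -- ψN and φN lie over G, the latter because it is inverse to the former
  ψN-over : ∀ x → node l₁′ (ψN x) ≡ node (l ⊕H l̄) x
  ψN-over (inj₁ k) = sym (square-node k)
  ψN-over (inj₂ (n , r)) = sym (fromRight-eq (node l₁′ n) r)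

  φN-over : ∀ n → node (l ⊕H l̄) (φN n) ≡ node l₁′ n
  φN-over n = trans (sym (ψN-over (φN n))) (cong (node l₁′) (ψφN n))

  -- ψN reflects polarization, since d′ does (being a pullback of a matching)
  ψN-reflects-pos : ∀ x → Pos D′ (ψN x) → Pos (K ⊕ K̄) x
  ψN-reflects-pos (inj₁ k) = proj₁ q-reflects k
  ψN-reflects-pos (inj₂ _) p = p

  ψN-reflects-neg : ∀ x → Neg D′ (ψN x) → Neg (K ⊕ K̄) x
  ψN-reflects-neg (inj₁ k) = proj₁ (proj₂ q-reflects) k
  ψN-reflects-neg (inj₂ _) p = p

  -- hence its inverse φN preserves polarization
  φN-pos : ∀ n → Pos D′ n → Pos (K ⊕ K̄) (φN n)
  φN-pos = preserve-by-inverse ψN φN ψφN ψN-reflects-pos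

  φN-neg : ∀ n → Neg D′ n → Neg (K ⊕ K̄) (φN n)
  φN-neg = preserve-by-inverse ψN φN ψφN ψN-reflects-neg

  -- K̃ and l̃ : the edges of D′ over L̃, attached to K + K̄ along φN
  K̃ : EdgeExt (K ⊕ K̄)
  K̃ = OverE (l ⊕H l̄) φN φN-over φN-pos φN-neg

  l̃ : EdgeExtHom (l ⊕H l̄) K̃ L̃
  l̃ = overE-hom (l ⊕H l̄) φN φN-over φN-pos φN-neg

  D : PGraph
  D = (K ⊕ K̄) +ₑ K̃

  l₁ : Hom D ((L ⊕ L̄) +ₑ L̃)
  l₁ = (l ⊕H l̄) +ₑH l̃

  EdgeClass : Edge D′ → Set
  EdgeClass e = ((Σ[ k ∈ Edge K ] edge d′ k ≡ e) ⊎ IsMid (edge l₁′ e)) ⊎ IsRight (edge l₁′ e)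

  classify-edge : ∀ e → EdgeClass e
  classify-edge e = by-image (edge l₁′ e) refl
    where
    by-image : ∀ w → edge l₁′ e ≡ w → EdgeClass e
    by-image (inj₁ (inj₁ a)) over = inj₁ (inj₁ (let (k , dk≡e , _) = lift-edge e a over in k , dk≡e))
    by-image (inj₁ (inj₂ _)) over = inj₁ (inj₂ (subst IsMid (sym over) tt))
    by-image (inj₂ _) over = inj₂ (subst IsRight (sym over) tt)

  edge-of : ∀ {e} → EdgeClass e → Edge D
  edge-of {e} = map (map proj₁ (e ,_)) (e ,_)

  φE : Edge D′ → Edge D
  φE e = edge-of (classify-edge e)

  ψE : Edge D → Edge D′
  ψE = [ [ edge d′ , proj₁ ] , proj₁ ]

  ψφE : ∀ e → ψE (φE e) ≡ e
  ψφE e = ψ-edge-of (classify-edge e)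
    where
    ψ-edge-of : ∀ {e} (c : EdgeClass e) → ψE (edge-of c) ≡ e
    ψ-edge-of (inj₁ (inj₁ (_ , dk≡e))) = dk≡e
    ψ-edge-of (inj₁ (inj₂ _)) = refl
    ψ-edge-of (inj₂ _) = refl

  d′-edge-not-over-L̄ : ∀ k → IsMid (edge l₁′ (edge d′ k)) → ⊥
  d′-edge-not-over-L̄ k = subst IsMid (sym (square-edge k))

  d′-edge-not-over-L̃ : ∀ k → IsRight (edge l₁′ (edge d′ k)) → ⊥
  d′-edge-not-over-L̃ k = subst IsRight (sym (square-edge k))

  φψE : ∀ x → φE (ψE x) ≡ x
  φψE (inj₁ (inj₁ k)) = edge-of-image (classify-edge (edge d′ k))
    where
    edge-of-image : (c : EdgeClass (edge d′ k)) → edge-of c ≡ inj₁ (inj₁ k)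
    edge-of-image (inj₁ (inj₁ (_ , dk′≡dk))) = cong (inj₁ ∘ inj₁) (q-injective-edge dk′≡dk)
    edge-of-image (inj₁ (inj₂ r)) = ⊥-elim (d′-edge-not-over-L̄ k r)
    edge-of-image (inj₂ r) = ⊥-elim (d′-edge-not-over-L̃ k r)
  φψE (inj₁ (inj₂ (e , r))) = edge-of-over-L̄ (classify-edge e)
    where
    edge-of-over-L̄ : (c : EdgeClass e) → edge-of c ≡ inj₁ (inj₂ (e , r))
    edge-of-over-L̄ (inj₁ (inj₁ (k , dk≡e))) =
      ⊥-elim (d′-edge-not-over-L̄ k (subst (IsMid ∘ edge l₁′) (sym dk≡e) r))
    edge-of-over-L̄ (inj₁ (inj₂ r′)) =
      cong (λ ρ → inj₁ (inj₂ (e , ρ))) (IsMid-irrelevant (edge l₁′ e) r′ r)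
    edge-of-over-L̄ (inj₂ r′) = ⊥-elim (mid-not-right (edge l₁′ e) r r′)
  φψE (inj₂ (e , r)) = edge-of-over-L̃ (classify-edge e)
    where
    edge-of-over-L̃ : (c : EdgeClass e) → edge-of c ≡ inj₂ (e , r)
    edge-of-over-L̃ (inj₁ (inj₁ (k , dk≡e))) =
      ⊥-elim (d′-edge-not-over-L̃ k (subst (IsRight ∘ edge l₁′) (sym dk≡e) r))
    edge-of-over-L̃ (inj₁ (inj₂ r′)) = ⊥-elim (mid-not-right (edge l₁′ e) r′ r)
    edge-of-over-L̃ (inj₂ r′) = cong (λ ρ → inj₂ (e , ρ)) (IsRight-irrelevant (edge l₁′ e) r′ r)

  ψE-over : ∀ x → edge l₁′ (ψE x) ≡ edge l₁ x
  ψE-over (inj₁ (inj₁ k)) = sym (square-edge k)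
  ψE-over (inj₁ (inj₂ (e , r))) = sym (fromMid-eq (edge l₁′ e) r)
  ψE-over (inj₂ (e , r)) = sym (fromRight-eq (edge l₁′ e) r)

  φE-over : ∀ e → edge l₁ (φE e) ≡ edge l₁′ e
  φE-over e = trans (sym (ψE-over (φE e))) (cong (edge l₁′) (ψφE e))

  ψE-reflects-pol : ∀ x → Pol D′ (ψE x) → Pol D x
  ψE-reflects-pol (inj₁ (inj₁ k)) = proj₂ (proj₂ q-reflects) k
  ψE-reflects-pol (inj₁ (inj₂ _)) p = p
  ψE-reflects-pol (inj₂ _) p = p

  ψ : Hom D D′
  ψ = record
    { node = ψN
    ; edge = ψE
    ; src-comm = λ { (inj₁ (inj₁ k)) → src-comm d′ k ; (inj₁ (inj₂ _)) → refl
                   ; (inj₂ (e , _)) → sym (ψφN (src D′ e)) }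
    ; tgt-comm = λ { (inj₁ (inj₁ k)) → tgt-comm d′ k ; (inj₁ (inj₂ _)) → refl
                   ; (inj₂ (e , _)) → sym (ψφN (tgt D′ e)) }
    ; pos-pres = λ { (inj₁ k) → pos-pres d′ k ; (inj₂ _) p → p }
    ; neg-pres = λ { (inj₁ k) → neg-pres d′ k ; (inj₂ _) p → p }
    ; pol-pres = λ { (inj₁ (inj₁ k)) → pol-pres d′ k ; (inj₁ (inj₂ _)) p → p ; (inj₂ _) p → p }
    }

  φ : Hom D′ D
  φ = inverseHom ψ φN φE φψN ψφN ψφE (ψN-reflects-pos , ψN-reflects-neg , ψE-reflects-pol)

  complement-iso : Σ[ K̄ ∈ PGraph ] Σ[ l̄ ∈ Hom K̄ L̄ ] Σ[ K̃ ∈ EdgeExt (K ⊕ K̄) ]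
    Σ[ l̃ ∈ EdgeExtHom (l ⊕H l̄) K̃ L̃ ] Σ[ φ ∈ Hom D′ ((K ⊕ K̄) +ₑ K̃) ]
      (IsIso φ × (φ ∘H d′) ≈ canon {K} {K̄} {K̃} × (((l ⊕H l̄) +ₑH l̃) ∘H φ) ≈ l₁′)
  complement-iso =
    K̄ , l̄ , K̃ , l̃ , φ ,
    (ψ , (ψφN , ψφE) , (φψN , φψE)) ,
    ((λ k → φψN (inj₁ k)) , (λ k → φψE (inj₁ (inj₁ k)))) ,
    (φN-over , φE-over)

proposition2p12 : (K L L̄ : PGraph) (L̃ : EdgeExt (L ⊕ L̄)) → IsDecomposition L L̄ L̃ → (l : Hom K L) →
    ((K̄ : PGraph) (l̄ : Hom K̄ L̄) (K̃ : EdgeExt (K ⊕ K̄)) (l̃ : EdgeExtHom (l ⊕H l̄) K̃ L̃) →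
      IsPullbackComplement (canon {L} {L̄} {L̃}) l ((l ⊕H l̄) +ₑH l̃) (canon {K} {K̄} {K̃}))
    ×
    ((D′ : PGraph) (l₁′ : Hom D′ ((L ⊕ L̄) +ₑ L̃)) (d′ : Hom K D′) →
      IsPullbackComplement (canon {L} {L̄} {L̃}) l l₁′ d′ →
      Σ[ K̄ ∈ PGraph ] Σ[ l̄ ∈ Hom K̄ L̄ ] Σ[ K̃ ∈ EdgeExt (K ⊕ K̄) ] Σ[ l̃ ∈ EdgeExtHom (l ⊕H l̄) K̃ L̃ ]
      Σ[ φ ∈ Hom D′ ((K ⊕ K̄) +ₑ K̃) ]
        (IsIso φ × (φ ∘H d′) ≈ canon {K} {K̄} {K̃} × (((l ⊕H l̄) +ₑH l̃) ∘H φ) ≈ l₁′))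
proposition2p12 K L L̄ L̃ _ l =
  (λ K̄ l̄ K̃ l̃ → canonical-square-is-pullback l l̄ l̃) ,
  (λ D′ l₁′ d′ pb → Complement.complement-iso {l = l} {l₁′ = l₁′} {d′ = d′} pb)
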